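{- Let $n\ge 1$ and $1\le k\le n$, and let $M_k$ be a matching of $k$ edges in the complete graph $K_{2n+1}$. Then $\chi'_L(K_{2n+1}\setminus M_k)=2n+1$ if $1\le k\le n-1$, and $\chi'_L(K_{2n+1}\setminus M_k)=2n$ if $k=n$.
   Context: $K_{2n+1}\setminus M_k$ denotes the graph obtained from $K_{2n+1}$ by deleting the edges of $M_k$. For a proper edge coloring $c:E(G)\to\{1,\dots,k\}$ of a connected graph $G$, let $\pi=(\mathcal{C}_1,\dots,\mathcal{C}_k)$ be the ordered partition of $E(G)$ into color classes. For a vertex $v$ and an edge $e=xy$, $d(v,e)=\min\{d(v,x),d(v,y)\}$, and $d(v,\mathcal{C}_i)=\min\{d(v,e): e\in\mathcal{C}_i\}$. The edge color code of $v$ is $c_\pi(v)=(d(v,\mathcal{C}_1),\dots,d(v,\mathcal{C}_k))$. The coloring is an edge-locating coloring if distinct vertices have distinct edge color codes; $\chi'_L(G)$ is the minimum number of colors in an edge-locating coloring of $G$. -}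

module Defs where

open import Data.Nat using (ℕ; zero; suc; _+_; _*_; _≤_; _⊓_)
open import Data.Fin using (Fin)
open import Data.Product using (Σ; ∃; _×_; _,_; proj₁; proj₂)
open import Data.Sum using (_⊎_)
open import Relation.Nullary using (¬_)
open import Relation.Binary.PropositionalEquality using (_≡_; _≢_)
open import Level using (0ℓ)

Graph : ℕ → Set₁
Graph N = Fin N → Fin N → Set

data Walk {N : ℕ} (G : Graph N) : Fin N → Fin N → ℕ → Set where
  here : ∀ {u} → Walk G u u zero
  step : ∀ {u w v l} → G u w → Walk G w v l → Walk G u v (suc l)

IsDist : ∀ {N} → Graph N → Fin N → Fin N → ℕ → Set
IsDist G u v d = Walk G u v d × (∀ m → Walk G u v m → d ≤ m)

-- Proper edge colouring with k colours, all colours used (so the colour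
-- classes form an ordered partition C_1,…,C_k of E(G)).
record EdgeColoring {N : ℕ} (G : Graph N) (k : ℕ) : Set where
  field
    col        : ∀ x y → G x y → Fin k
    symmetric  : ∀ x y (p : G x y) (q : G y x) → col x y p ≡ col y x q
    proper     : ∀ x y z (p : G x y) (q : G x z) → y ≢ z → col x y p ≢ col x z q
    surjective : ∀ (i : Fin k) → Σ (Fin N) λ x → Σ (Fin N) λ y → Σ (G x y) λ p → col x y p ≡ i

open EdgeColoring public

IsDistToEdge : ∀ {N} → Graph N → Fin N → Fin N → Fin N → ℕ → Set
IsDistToEdge G v x y d = Σ ℕ λ a → Σ ℕ λ b → IsDist G v x a × IsDist G v y b × d ≡ a ⊓ b

IsDistToClass : ∀ {N k} {G : Graph N} → EdgeColoring G k → Fin N → Fin k → ℕ → Set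
IsDistToClass {G = G} c v i d =
  (Σ (Fin _) λ x → Σ (Fin _) λ y → Σ (G x y) λ p → col c x y p ≡ i × IsDistToEdge G v x y d)
  × (∀ x y (p : G x y) → col c x y p ≡ i → ∀ e → IsDistToEdge G v x y e → d ≤ e)

CodesDiffer : ∀ {N k} {G : Graph N} → EdgeColoring G k → Fin N → Fin N → Set
CodesDiffer c u v = Σ (Fin _) λ i → Σ ℕ λ d → Σ ℕ λ d' →
  IsDistToClass c u i d × IsDistToClass c v i d' × d ≢ d'

record EdgeLocatingColoring {N : ℕ} (G : Graph N) (k : ℕ) : Set where
  field
    coloring : EdgeColoring G k
    locating : ∀ u v → u ≢ v → CodesDiffer coloring u v

EdgeLocatingChromaticIndex : ∀ {N} → Graph N → ℕ → Set
EdgeLocatingChromaticIndex G m =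
  EdgeLocatingColoring G m × (∀ j → EdgeLocatingColoring G j → m ≤ j)

IsMatching : ∀ {N k} → (Fin k → Fin N × Fin N) → Set
IsMatching {k = k} M =
  (∀ i → proj₁ (M i) ≢ proj₂ (M i)) ×
  (∀ i j → i ≢ j →
     proj₁ (M i) ≢ proj₁ (M j) × proj₁ (M i) ≢ proj₂ (M j) ×
     proj₂ (M i) ≢ proj₁ (M j) × proj₂ (M i) ≢ proj₂ (M j))

InMatching : ∀ {N k} → (Fin k → Fin N × Fin N) → Fin N → Fin N → Set
InMatching M u v = ∃ λ i → (M i ≡ (u , v)) ⊎ (M i ≡ (v , u))

CompleteMinus : ∀ {N k} → (Fin k → Fin N × Fin N) → Graph N
CompleteMinus M u v = u ≢ v × ¬ InMatching M u v

-- Write N = 2n + 1. Label the vertices bijectively by 0, …, 2n so that an unmatched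
-- root gets 0 and the i-th matching edge gets i + 1 and 2n − i, and colour uv by
-- (ℓ u + ℓ v) mod N, as in the classical 1-factorisation of K_N. Labels are distinct,
-- so the colouring is proper, and the one colour missing at u is 2 ℓ u mod N, which
-- determines u since N is odd. Of two vertices u ≠ v one has 2 ℓ u ≢ 0; that colour
-- then occurs at v on an edge outside the matching, while every edge avoiding u lies
-- at distance 1 from u, so the codes of u and v differ there. For k = n every
-- non-root vertex is matched, so colour 0 lives only on deleted edges and 2n colours
-- remain. Conversely an unmatched vertex has degree 2n, so 2n colours are needed, and
-- with exactly 2n it sees all of them; for k < n there are two unmatched vertices and
-- both have the all-zero code.

module Submission where

open import Defs

open import Data.Nat
  using (ℕ; zero; suc; _+_; _*_; _∸_; _≤_; _<_; _⊓_; z≤n; s≤s; s≤s⁻¹; NonZero; _<?_)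
open import Data.Nat.Properties renaming (_≟_ to _≟ℕ_)
open import Data.Nat.DivMod using (_%_; m<n⇒m%n≡m; [m+n]%n≡m%n; %-congˡ; n%n≡0; m%n<n)
open import Data.Nat.Tactic.RingSolver using (solve-∀)
open import Data.Fin
  using (Fin; zero; suc; toℕ; fromℕ<; splitAt; join; punchIn; inject≤; opposite; _↑ˡ_; _↑ʳ_)
open import Data.Fin.Properties as Fin
  using ( any?; ¬∀⟶∃¬; injective⇒≤; _≟_; join-splitAt; punchIn-injective; punchInᵢ≢i
        ; toℕ-injective; toℕ<n; toℕ-fromℕ<; toℕ-inject≤; inject≤-injective
        ; opposite-involutive; opposite-prop)
open import Data.Fin.Permutation.Components using (transpose; transpose-inverse)
open import Data.Vec.Functional using ([]; _∷_; _++_)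
open import Data.Vec.Functional.Properties using (lookup-++ˡ; lookup-++ʳ)
open import Data.Product using (Σ; ∃; ∃₂; _×_; _,_; proj₁; proj₂)
open import Data.Product.Properties using (≡-dec)
open import Data.Sum using (_⊎_; inj₁; inj₂; [_,_])
open import Data.Empty using (⊥-elim)
open import Function using (_∘_; id)
open import Function.Definitions using (Injective)
open import Relation.Nullary using (¬_; Dec; yes; no; contradiction)
open import Relation.Nullary.Decidable using (_⊎-dec_)
open import Relation.Binary.Definitions using (tri<; tri≈; tri>)
open import Relation.Binary.PropositionalEquality hiding ([_])
open ≡-Reasoning

-- Injections between finite sets

_∉-image_ : ∀ {m N} → Fin N → (Fin m → Fin N) → Set
v ∉-image f = ∀ x → f x ≢ v

∃-∉-image : ∀ {m N} (f : Fin m → Fin N) → m < N → ∃ λ v → v ∉-image f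
∃-∉-image {m} {N} f m<N =
  let v , v∉ = ¬∀⟶∃¬ N (λ v → ∃ λ x → f x ≡ v) (λ v → any? λ x → f x ≟ v) ¬onto
  in v , λ x fx≡v → v∉ (x , fx≡v)
  where
  ¬onto : ¬ (∀ v → ∃ λ x → f x ≡ v)
  ¬onto onto = <⇒≱ m<N (injective⇒≤ section-injective)
    where
    section-injective : Injective _≡_ _≡_ (proj₁ ∘ onto)
    section-injective {v} {v′} eq =
      trans (sym (proj₂ (onto v))) (trans (cong f eq) (proj₂ (onto v′)))

injective-∷ : ∀ {m N} {v : Fin N} {f : Fin m → Fin N} →
              v ∉-image f → Injective _≡_ _≡_ f → Injective _≡_ _≡_ (v ∷ f)
injective-∷ v∉ f-inj {zero}  {zero}  _  = refl
injective-∷ v∉ f-inj {zero}  {suc y} eq = ⊥-elim (v∉ y (sym eq))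
injective-∷ v∉ f-inj {suc x} {zero}  eq = ⊥-elim (v∉ x eq)
injective-∷ v∉ f-inj {suc x} {suc y} eq = cong suc (f-inj eq)

injective-++ : ∀ {m m′ N} {f : Fin m → Fin N} {g : Fin m′ → Fin N} →
               Injective _≡_ _≡_ f → Injective _≡_ _≡_ g → (∀ x y → f x ≢ g y) →
               Injective _≡_ _≡_ (f ++ g)
injective-++ {m} {m′} {f = f} {g} f-inj g-inj disjoint {x} {y} eq = begin
  x                        ≡⟨ join-splitAt m m′ x ⟨
  join m m′ (splitAt m x)  ≡⟨ cong (join m m′) (copair-injective (splitAt m x) (splitAt m y) eq) ⟩
  join m m′ (splitAt m y)  ≡⟨ join-splitAt m m′ y ⟩
  y                        ∎
  where
  copair-injective : ∀ s t → [ f , g ] s ≡ [ f , g ] t → s ≡ t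
  copair-injective (inj₁ a) (inj₁ b) eq = cong inj₁ (f-inj eq)
  copair-injective (inj₁ a) (inj₂ b) eq = ⊥-elim (disjoint a b eq)
  copair-injective (inj₂ a) (inj₁ b) eq = ⊥-elim (disjoint b a (sym eq))
  copair-injective (inj₂ a) (inj₂ b) eq = cong inj₂ (g-inj eq)

∉-image-++ : ∀ {m m′ N} {v : Fin N} {f : Fin m → Fin N} {g : Fin m′ → Fin N} →
             v ∉-image f → v ∉-image g → v ∉-image (f ++ g)
∉-image-++ {m} v∉f v∉g x with splitAt m x
... | inj₁ a = v∉f a
... | inj₂ b = v∉g b

injective⇒surjective : ∀ {m} {f : Fin m → Fin m} → Injective _≡_ _≡_ f →
                       ∀ y → ∃ λ x → f x ≡ y
injective⇒surjective {m} {f} f-inj y with any? (λ x → f x ≟ y)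
... | yes hit  = hit
... | no  miss =
  contradiction (injective⇒≤ (injective-∷ (λ x fx≡y → miss (x , fx≡y)) f-inj)) (n≮n m)

transposeˡ : ∀ {N} (i j : Fin N) → transpose i j i ≡ j
transposeˡ i j with i ≟ i
... | yes _   = refl
... | no  i≢i = contradiction refl i≢i

transpose-fix : ∀ {N} {i j k : Fin N} → k ≢ i → k ≢ j → transpose i j k ≡ k
transpose-fix {i = i} {j} {k} k≢i k≢j with k ≟ i
... | yes k≡i = contradiction k≡i k≢i
... | no  _ with k ≟ j
...   | yes k≡j = contradiction k≡j k≢j
...   | no  _   = refl

transpose-injective : ∀ {N} (i j : Fin N) → Injective _≡_ _≡_ (transpose i j)
transpose-injective i j {x} {y} eq =
  trans (sym (transpose-inverse j i)) (trans (cong (transpose j i) eq) (transpose-inverse j i))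

extend-to-permutation : ∀ {m N} (f t : Fin m → Fin N) →
                        Injective _≡_ _≡_ f → Injective _≡_ _≡_ t →
                        ∃ λ (π : Fin N → Fin N) → Injective _≡_ _≡_ π × (∀ x → π (f x) ≡ t x)
extend-to-permutation {zero} f t _ _ = id , id , λ ()
extend-to-permutation {suc m} f t f-inj t-inj
  with π , π-inj , π-ext ← extend-to-permutation (f ∘ suc) (t ∘ suc)
                              (Fin.suc-injective ∘ f-inj) (Fin.suc-injective ∘ t-inj)
  = transpose (π (f zero)) (t zero) ∘ π , π-inj ∘ transpose-injective _ _ , ext
  where
  ext : ∀ x → transpose (π (f zero)) (t zero) (π (f x)) ≡ t x
  ext zero    = transposeˡ (π (f zero)) (t zero)
  ext (suc x) = trans (cong (transpose _ _) (π-ext x)) (transpose-fix tx≢πf₀ tx≢t₀)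
    where
    tx≢πf₀ : t (suc x) ≢ π (f zero)
    tx≢πf₀ eq with () ← f-inj (π-inj (trans (π-ext x) eq))
    tx≢t₀ : t (suc x) ≢ t zero
    tx≢t₀ eq with () ← t-inj eq

-- Residues of sums modulo N

%-of-sum : ∀ {N a b} .{{_ : NonZero N}} → a < N → b < N →
           (a + b) % N ≡ a + b ⊎ (a + b) % N + N ≡ a + b
%-of-sum {N} {a} {b} a<N b<N with a + b <? N
... | yes a+b<N = inj₁ (m<n⇒m%n≡m a+b<N)
... | no  a+b≮N = inj₂ (begin
  (a + b) % N + N             ≡⟨ cong (_+ N) (%-congˡ (m∸n+n≡m N≤a+b)) ⟨
  ((a + b ∸ N) + N) % N + N   ≡⟨ cong (_+ N) ([m+n]%n≡m%n (a + b ∸ N) N) ⟩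
  (a + b ∸ N) % N + N         ≡⟨ cong (_+ N) (m<n⇒m%n≡m a+b∸N<N) ⟩
  a + b ∸ N + N               ≡⟨ m∸n+n≡m N≤a+b ⟩
  a + b                       ∎)
  where
  N≤a+b : N ≤ a + b
  N≤a+b = ≮⇒≥ a+b≮N
  a+b∸N<N : a + b ∸ N < N
  a+b∸N<N = +-cancelʳ-< _ _ N (subst (_< N + N) (sym (m∸n+n≡m N≤a+b)) (+-mono-< a<N b<N))

%-of-sum≡0 : ∀ {N a b} .{{_ : NonZero N}} → a < N → b < N →
             (a + b) % N ≡ 0 → a + b ≡ 0 ⊎ a + b ≡ N
%-of-sum≡0 a<N b<N r≡0 with %-of-sum a<N b<N
... | inj₁ r≡a+b   = inj₁ (trans (sym r≡a+b) r≡0)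
... | inj₂ r+N≡a+b = inj₂ (trans (sym r+N≡a+b) (cong (_+ _) r≡0))

[m+n]+o≡m+p⇒o≤p : ∀ {m n o p} → m + n + o ≡ m + p → o ≤ p
[m+n]+o≡m+p⇒o≤p {m} {n} {o} {p} eq =
  subst (o ≤_) (+-cancelˡ-≡ m _ _ (trans (sym (+-assoc m n o)) eq)) (m≤n+m o n)

+-%-cancelˡ : ∀ {N a b c} .{{_ : NonZero N}} → a < N → b < N → c < N →
              (a + b) % N ≡ (a + c) % N → b ≡ c
+-%-cancelˡ {N} {a} {b} {c} a<N b<N c<N eq with %-of-sum a<N b<N | %-of-sum a<N c<N
... | inj₁ p | inj₁ q = +-cancelˡ-≡ a b c (trans (sym p) (trans eq q))
... | inj₂ p | inj₂ q = +-cancelˡ-≡ a b c (trans (sym p) (trans (cong (_+ N) eq) q))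
... | inj₁ p | inj₂ q =
  contradiction ([m+n]+o≡m+p⇒o≤p (trans (cong (_+ N) (trans (sym p) eq)) q)) (<⇒≱ c<N)
... | inj₂ p | inj₁ q =
  contradiction ([m+n]+o≡m+p⇒o≤p (trans (cong (_+ N) (trans (sym q) (sym eq))) p)) (<⇒≱ b<N)

m+m≡n+n⇒m≡n : ∀ {m n} → m + m ≡ n + n → m ≡ n
m+m≡n+n⇒m≡n {m} {n} eq with <-cmp m n
... | tri< m<n _ _ = contradiction eq (<⇒≢ (+-mono-< m<n m<n))
... | tri≈ _ m≡n _ = m≡n
... | tri> _ _ n<m = contradiction (sym eq) (<⇒≢ (+-mono-< n<m n<m))

n+n≢m+m+odd : ∀ k m n → n + n ≢ m + m + suc (2 * k)
n+n≢m+m+odd k m n eq = even≢odd n (m + k) (begin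
  2 * n                   ≡⟨ double n ⟩
  n + n                   ≡⟨ eq ⟩
  m + m + suc (2 * k)     ≡⟨ odd m k ⟩
  suc (2 * (m + k))       ∎)
  where
  double : ∀ n → 2 * n ≡ n + n
  double = solve-∀
  odd : ∀ m k → m + m + suc (2 * k) ≡ suc (2 * (m + k))
  odd = solve-∀

double-%-injective : ∀ n {a b} → a < suc (2 * n) → b < suc (2 * n) →
                     (a + a) % suc (2 * n) ≡ (b + b) % suc (2 * n) → a ≡ b
double-%-injective n {a} {b} a<N b<N eq with %-of-sum a<N a<N | %-of-sum b<N b<N
... | inj₁ p | inj₁ q = m+m≡n+n⇒m≡n (trans (sym p) (trans eq q))
... | inj₂ p | inj₂ q = m+m≡n+n⇒m≡n (trans (sym p) (trans (cong (_+ suc (2 * n)) eq) q))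
... | inj₁ p | inj₂ q =
  ⊥-elim (n+n≢m+m+odd n a b (trans (sym q) (cong (_+ suc (2 * n)) (trans (sym eq) p))))
... | inj₂ p | inj₁ q =
  ⊥-elim (n+n≢m+m+odd n b a (trans (sym p) (cong (_+ suc (2 * n)) (trans eq q))))

-- Distances and colour codes in K_N minus a matching

module MatchingComplement {m k : ℕ} (M : Fin k → Fin (suc m) × Fin (suc m))
                          (matching : IsMatching M) where

  G : Graph (suc m)
  G = CompleteMinus M

  Endpoint : Fin k → Fin (suc m) → Set
  Endpoint i u = proj₁ (M i) ≡ u ⊎ proj₂ (M i) ≡ u

  endpoint-unique : ∀ {i j u} → Endpoint i u → Endpoint j u → i ≡ j
  endpoint-unique {i} {j} p q with i ≟ j
  ... | yes i≡j = i≡j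
  ... | no  i≢j with proj₂ matching i j i≢j
  ...   | a≢a , a≢b , b≢a , b≢b with p | q
  ...     | inj₁ a | inj₁ a′ = ⊥-elim (a≢a (trans a (sym a′)))
  ...     | inj₁ a | inj₂ b′ = ⊥-elim (a≢b (trans a (sym b′)))
  ...     | inj₂ b | inj₁ a′ = ⊥-elim (b≢a (trans b (sym a′)))
  ...     | inj₂ b | inj₂ b′ = ⊥-elim (b≢b (trans b (sym b′)))

  matched-endpoint : ∀ {u v} → (p : InMatching M u v) → Endpoint (proj₁ p) u
  matched-endpoint (i , inj₁ e) = inj₁ (cong proj₁ e)
  matched-endpoint (i , inj₂ e) = inj₂ (cong proj₂ e)

  InMatching-sym : ∀ {u v} → InMatching M u v → InMatching M v u
  InMatching-sym (i , inj₁ e) = i , inj₂ e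
  InMatching-sym (i , inj₂ e) = i , inj₁ e

  partner-unique : ∀ {u x y} → InMatching M u x → InMatching M u y → x ≡ y
  partner-unique p@(i , _) q@(j , _) with endpoint-unique (matched-endpoint p) (matched-endpoint q)
  partner-unique (i , inj₁ e) (.i , inj₁ e′) | refl = cong proj₂ (trans (sym e) e′)
  partner-unique (i , inj₂ e) (.i , inj₂ e′) | refl = cong proj₁ (trans (sym e) e′)
  partner-unique (i , inj₁ e) (.i , inj₂ e′) | refl =
    ⊥-elim (proj₁ matching i (trans (cong proj₁ e) (sym (cong proj₂ e′))))
  partner-unique (i , inj₂ e) (.i , inj₁ e′) | refl =
    ⊥-elim (proj₁ matching i (trans (cong proj₁ e′) (sym (cong proj₂ e))))

  InMatching? : ∀ u v → Dec (InMatching M u v)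
  InMatching? u v = any? λ i → ≡-dec _≟_ _≟_ (M i) (u , v) ⊎-dec ≡-dec _≟_ _≟_ (M i) (v , u)

  G-sym : ∀ {u v} → G u v → G v u
  G-sym (u≢v , ¬uv) = u≢v ∘ sym , ¬uv ∘ InMatching-sym

  G-irrefl : ∀ {u} → ¬ G u u
  G-irrefl (u≢u , _) = u≢u refl

  adjacent-to-either : ∀ {u x y} → u ≢ x → u ≢ y → x ≢ y → G u x ⊎ G u y
  adjacent-to-either {u} {x} {y} u≢x u≢y x≢y with InMatching? u x | InMatching? u y
  ... | no ¬ux | _       = inj₁ (u≢x , ¬ux)
  ... | yes _  | no ¬uy  = inj₂ (u≢y , ¬uy)
  ... | yes ux | yes uy  = ⊥-elim (x≢y (partner-unique ux uy))

  Unmatched : Fin (suc m) → Set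
  Unmatched z = ∀ {v} → ¬ InMatching M z v

  unmatched-adjacent : ∀ {z v} → Unmatched z → z ≢ v → G z v
  unmatched-adjacent z-unm z≢v = z≢v , z-unm

  dist-refl : ∀ {u} → IsDist G u u 0
  dist-refl = here , λ _ _ → z≤n

  walk-nonempty : ∀ {u x d} → u ≢ x → Walk G u x d → 1 ≤ d
  walk-nonempty u≢x here       = contradiction refl u≢x
  walk-nonempty u≢x (step _ _) = s≤s z≤n

  dist-adjacent : ∀ {u x} → G u x → IsDist G u x 1
  dist-adjacent ux = step ux here , λ _ → walk-nonempty (proj₁ ux)

  dist-two : ∀ {u w x} → u ≢ x → ¬ G u x → G u w → G w x → IsDist G u x 2
  dist-two {u} {x = x} u≢x ¬ux uw wx = step uw (step wx here) , shortest
    where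
    shortest : ∀ d → Walk G u x d → 2 ≤ d
    shortest _ here                = contradiction refl u≢x
    shortest _ (step ux here)      = contradiction ux ¬ux
    shortest _ (step _ (step _ _)) = s≤s (s≤s z≤n)

  ∃-dist : 2 ≤ m → ∀ {u x} → u ≢ x → ∃ λ d → IsDist G u x d × 1 ≤ d × (G u x → d ≡ 1)
  ∃-dist 2≤m {u} {x} u≢x with InMatching? u x
  ... | no ¬ux = 1 , dist-adjacent (u≢x , ¬ux) , s≤s z≤n , λ _ → refl
  ... | yes ux =
    let w , w∉ = ∃-∉-image (u ∷ x ∷ []) (s≤s 2≤m)
        w≢u = w∉ zero ∘ sym
        w≢x = w∉ (suc zero) ∘ sym
    in 2 , dist-two u≢x (λ ux′ → proj₂ ux′ ux)
                     (w≢u ∘ sym , λ uw → w≢x (sym (partner-unique ux uw)))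
                     (w≢x , λ wx → w≢u (sym (partner-unique (InMatching-sym ux) (InMatching-sym wx))))
         , s≤s z≤n , λ ux′ → contradiction ux (proj₂ ux′)

  dist-pos : ∀ {u x d} → IsDist G u x d → u ≢ x → 1 ≤ d
  dist-pos (walk , _) u≢x = walk-nonempty u≢x walk

  distToEdge-outside : 2 ≤ m → ∀ {u x y} → u ≢ x → u ≢ y → x ≢ y → IsDistToEdge G u x y 1
  distToEdge-outside 2≤m u≢x u≢y x≢y
    with ∃-dist 2≤m u≢x | ∃-dist 2≤m u≢y | adjacent-to-either u≢x u≢y x≢y
  ... | a , ux , 1≤a , adj⇒a≡1 | b , uy , 1≤b , _        | inj₁ adj =
    a , b , ux , uy , subst (λ a → 1 ≡ a ⊓ b) (sym (adj⇒a≡1 adj)) (sym (m≤n⇒m⊓n≡m 1≤b))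
  ... | a , ux , 1≤a , _        | b , uy , 1≤b , adj⇒b≡1 | inj₂ adj =
    a , b , ux , uy , subst (λ b → 1 ≡ a ⊓ b) (sym (adj⇒b≡1 adj)) (sym (m≥n⇒m⊓n≡n 1≤a))

  module _ {j} (c : EdgeColoring G j) where

    Misses : Fin (suc m) → Fin j → Set
    Misses u i = ∀ y (p : G u y) → col c u y p ≢ i

    misses⇒off-edge : ∀ {u i x y} (p : G x y) → Misses u i → col c x y p ≡ i → u ≢ x × u ≢ y
    misses⇒off-edge {x = x} {y} p miss xy-i =
      (λ { refl → miss y p xy-i }) ,
      (λ { refl → miss x (G-sym p) (trans (symmetric c _ x (G-sym p) p) xy-i) })

    distToEdge-incident : ∀ {v y} → G v y → IsDistToEdge G v v y 0
    distToEdge-incident p = 0 , 1 , dist-refl , dist-adjacent p , refl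

    distToClass-incident : ∀ {v y i} (p : G v y) → col c v y p ≡ i → IsDistToClass c v i 0
    distToClass-incident p vy-i = (_ , _ , p , vy-i , distToEdge-incident p) , λ _ _ _ _ _ _ → z≤n

    distToClass-incident≡0 : ∀ {v y i d} (p : G v y) → col c v y p ≡ i →
                             IsDistToClass c v i d → d ≡ 0
    distToClass-incident≡0 p vy-i (_ , least) = n≤0⇒n≡0 (least _ _ p vy-i 0 (distToEdge-incident p))

    distToClass-missed : 2 ≤ m → ∀ {u x y i} (p : G x y) → col c x y p ≡ i → Misses u i →
                         IsDistToClass c u i 1
    distToClass-missed 2≤m {u} {x} {y} {i} p xy-i miss =
      (x , y , p , xy-i , distToEdge-outside 2≤m u≢x u≢y (proj₁ p)) , least
      where
      u≢x = proj₁ (misses⇒off-edge p miss xy-i)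
      u≢y = proj₂ (misses⇒off-edge p miss xy-i)
      least : ∀ x′ y′ (q : G x′ y′) → col c x′ y′ q ≡ i →
              ∀ e → IsDistToEdge G u x′ y′ e → 1 ≤ e
      least _ _ q q-i e (a , b , ux′ , uy′ , e≡a⊓b) =
        let u≢x′ , u≢y′ = misses⇒off-edge q miss q-i
        in subst (1 ≤_) (sym e≡a⊓b) (⊓-glb (dist-pos ux′ u≢x′) (dist-pos uy′ u≢y′))

    codesDiffer-missed-seen : 2 ≤ m → ∀ {u v y i} → Misses u i →
                              (p : G v y) → col c v y p ≡ i → CodesDiffer c u v
    codesDiffer-missed-seen 2≤m miss p vy-i =
      _ , 1 , 0 , distToClass-missed 2≤m p vy-i miss , distToClass-incident p vy-i , λ ()

    CodesDiffer-sym : ∀ {u v} → CodesDiffer c u v → CodesDiffer c v u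
    CodesDiffer-sym (i , d , d′ , u-i , v-i , d≢d′) = i , d′ , d , v-i , u-i , d≢d′ ∘ sym

    module _ {z} (z-unm : Unmatched z) where

      colourAround : Fin m → Fin j
      colourAround x = col c z (punchIn z x) (unmatched-adjacent z-unm (punchInᵢ≢i z x ∘ sym))

      colourAround-injective : Injective _≡_ _≡_ colourAround
      colourAround-injective {x} {y} eq with punchIn z x ≟ punchIn z y
      ... | yes e  = punchIn-injective z x y e
      ... | no  ne = contradiction eq (proper c z _ _ _ _ ne)

      unmatched⇒≤colours : m ≤ j
      unmatched⇒≤colours = injective⇒≤ colourAround-injective

  unmatched-sees-every-colour : ∀ (c : EdgeColoring G m) {z} → Unmatched z →
                                ∀ i → ∃₂ λ y (p : G z y) → col c z y p ≡ i
  unmatched-sees-every-colour c {z} z-unm i =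
    let x , e = injective⇒surjective (colourAround-injective c z-unm) i in punchIn z x , _ , e

  two-unmatched⇒¬locating : ∀ {z z′} → Unmatched z → Unmatched z′ → z ≢ z′ →
                            ¬ EdgeLocatingColoring G m
  two-unmatched⇒¬locating z-unm z′-unm z≢z′ el
    with i , d , d′ , z-i , z′-i , d≢d′ ← EdgeLocatingColoring.locating el _ _ z≢z′ =
    d≢d′ (trans (at-unmatched z-unm z-i) (sym (at-unmatched z′-unm z′-i)))
    where
    c = EdgeLocatingColoring.coloring el
    at-unmatched : ∀ {w e} → Unmatched w → IsDistToClass c w i e → e ≡ 0
    at-unmatched w-unm w-i =
      let _ , p , e = unmatched-sees-every-colour c w-unm i in distToClass-incident≡0 c p e w-i

-- Colouring by label sums

record Labelling (n : ℕ) {k} (M : Fin k → Fin (suc (2 * n)) × Fin (suc (2 * n))) : Set where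
  field
    label           : Fin (suc (2 * n)) → ℕ
    label<N         : ∀ v → label v < suc (2 * n)
    label-injective : Injective _≡_ _≡_ label
    label-partner   : ∀ {u v} → InMatching M u v → label u + label v ≡ suc (2 * n)

module LabelSums (n : ℕ) {k} {M : Fin k → Fin (suc (2 * n)) × Fin (suc (2 * n))}
                 (matching : IsMatching M) (L : Labelling n M) where
  open MatchingComplement M matching
  open Labelling L

  N : ℕ
  N = suc (2 * n)

  labelSum : Fin N → Fin N → ℕ
  labelSum u v = (label u + label v) % N

  labelSum<N : ∀ u v → labelSum u v < N
  labelSum<N u v = m%n<n (label u + label v) N

  labelSum-comm : ∀ u v → labelSum u v ≡ labelSum v u
  labelSum-comm u v = cong (_% N) (+-comm (label u) (label v))

  labelSum-cancelˡ : ∀ {u x y} → labelSum u x ≡ labelSum u y → x ≡ y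
  labelSum-cancelˡ {u} {x} {y} eq =
    label-injective (+-%-cancelˡ (label<N u) (label<N x) (label<N y) eq)

  labelSum-diag-injective : ∀ {u v} → labelSum u u ≡ labelSum v v → u ≡ v
  labelSum-diag-injective {u} {v} eq =
    label-injective (double-%-injective n (label<N u) (label<N v) eq)

  labelSum-partner : ∀ {u v} → InMatching M u v → labelSum u v ≡ 0
  labelSum-partner uv = trans (cong (_% N) (label-partner uv)) (n%n≡0 N)

  labelSum-onto : ∀ v t → t < N → ∃ λ y → labelSum v y ≡ t
  labelSum-onto v t t<N =
    let y , e = injective⇒surjective residue-injective (fromℕ< t<N)
    in y , trans (sym (toℕ-fromℕ< (labelSum<N v y))) (trans (cong toℕ e) (toℕ-fromℕ< t<N))
    where
    residue : Fin N → Fin N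
    residue y = fromℕ< (labelSum<N v y)
    residue-injective : Injective _≡_ _≡_ residue
    residue-injective {x} {y} eq = labelSum-cancelˡ (trans (sym (toℕ-fromℕ< (labelSum<N v x)))
                                                           (trans (cong toℕ eq) (toℕ-fromℕ< (labelSum<N v y))))

  unmatched-edge-with-sum : ∀ {z t} → Unmatched z → labelSum z z ≢ t → t < N →
                            ∃₂ λ y (p : G z y) → labelSum z y ≡ t
  unmatched-edge-with-sum {z} z-unm zz≢t t<N =
    let y , zy≡t = labelSum-onto z _ t<N
    in y , unmatched-adjacent z-unm (λ z≡y → zz≢t (trans (cong (labelSum z) z≡y) zy≡t)) , zy≡t

  edge-with-diagonal-sum : ∀ {u v} → u ≢ v → labelSum u u ≢ 0 →
                           ∃₂ λ y (p : G v y) → labelSum v y ≡ labelSum u u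
  edge-with-diagonal-sum {u} {v} u≢v uu≢0 =
    let y , vy≡uu = labelSum-onto v _ (labelSum<N u u)
    in y , ((λ v≡y → u≢v (labelSum-diag-injective (sym (trans (cong (labelSum v) v≡y) vy≡uu)))) ,
            (λ vy → uu≢0 (trans (sym vy≡uu) (labelSum-partner vy)))) , vy≡uu

  matched-if-sum≡0 : (∀ u → label u ≡ 0 ⊎ ∃ λ u′ → InMatching M u u′) →
                     ∀ {u v} → u ≢ v → labelSum u v ≡ 0 → InMatching M u v
  matched-if-sum≡0 covered {u} {v} u≢v uv≡0 with %-of-sum≡0 (label<N u) (label<N v) uv≡0
  ... | inj₁ sum≡0 =
    contradiction (label-injective (trans (m+n≡0⇒m≡0 _ sum≡0) (sym (m+n≡0⇒n≡0 _ sum≡0)))) u≢v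
  ... | inj₂ sum≡N with covered u
  ...   | inj₁ u≡0 = contradiction (trans (sym (cong (_+ label v) u≡0)) sum≡N) (<⇒≢ (label<N v))
  ...   | inj₂ (u′ , uu′) = subst (InMatching M u)
          (label-injective (+-cancelˡ-≡ (label u) _ _ (trans (label-partner uu′) (sym sum≡N)))) uu′

  -- Colours are label sums minus o; taking o = 1 discards the residue 0, which for
  -- k = n only occurs on deleted matching edges.
  module SumColouring (o : ℕ) (o≤N : o ≤ N) (2≤2n : 2 ≤ 2 * n)
                      (o≤sum : ∀ {u v} → G u v → o ≤ labelSum u v)
                      (source : ∀ t → o ≤ t → t < N →
                                ∃ λ z → Unmatched z × labelSum z z ≢ t) where

    colour : ∀ u v → G u v → Fin (N ∸ o)
    colour u v p = fromℕ< (∸-monoˡ-< (labelSum<N u v) (o≤sum p))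

    toℕ-colour : ∀ {u v} (p : G u v) → toℕ (colour u v p) ≡ labelSum u v ∸ o
    toℕ-colour {u} {v} p = toℕ-fromℕ< (∸-monoˡ-< (labelSum<N u v) (o≤sum p))

    colour-injective : ∀ {u v x y} (p : G u v) (q : G x y) →
                       colour u v p ≡ colour x y q → labelSum u v ≡ labelSum x y
    colour-injective p q eq =
      ∸-cancelʳ-≡ (o≤sum p) (o≤sum q)
        (trans (sym (toℕ-colour p)) (trans (cong toℕ eq) (toℕ-colour q)))

    colour-cong : ∀ {u v x y} (p : G u v) (q : G x y) →
                  labelSum u v ≡ labelSum x y → colour u v p ≡ colour x y q
    colour-cong p q eq =
      toℕ-injective (trans (toℕ-colour p) (trans (cong (_∸ o) eq) (sym (toℕ-colour q))))

    colour-onto : ∀ i → ∃₂ λ x y → Σ (G x y) λ p → colour x y p ≡ i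
    colour-onto i =
      let z , z-unm , zz≢t = source t (m≤n+m o (toℕ i)) t<N
          y , p , zy≡t     = unmatched-edge-with-sum z-unm zz≢t t<N
      in z , y , p , toℕ-injective (begin
           toℕ (colour z y p)     ≡⟨ toℕ-colour p ⟩
           labelSum z y ∸ o       ≡⟨ cong (_∸ o) zy≡t ⟩
           toℕ i + o ∸ o          ≡⟨ m+n∸n≡m (toℕ i) o ⟩
           toℕ i                  ∎)
      where
      t = toℕ i + o
      t<N : t < N
      t<N = subst (t <_) (m∸n+n≡m o≤N) (+-monoˡ-< o (toℕ<n i))

    colouring : EdgeColoring G (N ∸ o)
    colouring = record
      { col        = colour
      ; symmetric  = λ u v p q → colour-cong p q (labelSum-comm u v)
      ; proper     = λ x y z p q y≢z eq → y≢z (labelSum-cancelˡ (colour-injective p q eq))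
      ; surjective = colour-onto
      }

    misses-diagonal : ∀ {u v y} (p : G v y) → labelSum v y ≡ labelSum u u →
                      Misses colouring u (colour v y p)
    misses-diagonal {u} p vy≡uu x q eq =
      G-irrefl (subst (G u) (labelSum-cancelˡ (trans (colour-injective q p eq) vy≡uu)) q)

    codesDiffer-nonzero : ∀ {u v} → u ≢ v → labelSum u u ≢ 0 → CodesDiffer colouring u v
    codesDiffer-nonzero u≢v uu≢0 =
      let y , p , vy≡uu = edge-with-diagonal-sum u≢v uu≢0
      in codesDiffer-missed-seen colouring 2≤2n (misses-diagonal p vy≡uu) p refl

    locating : ∀ u v → u ≢ v → CodesDiffer colouring u v
    locating u v u≢v with labelSum u u ≟ℕ 0
    ... | no  uu≢0 = codesDiffer-nonzero u≢v uu≢0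
    ... | yes uu≡0 = CodesDiffer-sym colouring (codesDiffer-nonzero (u≢v ∘ sym)
                       (λ vv≡0 → u≢v (labelSum-diag-injective (trans uu≡0 (sym vv≡0)))))

    edgeLocatingColouring : EdgeLocatingColoring G (N ∸ o)
    edgeLocatingColouring = record { coloring = colouring ; locating = locating }

-- Constructing the labelling

module LabellingConstruction {n k} (k≤n : k ≤ n)
                             (M : Fin k → Fin (suc (2 * n)) × Fin (suc (2 * n)))
                             (matching : IsMatching M) where
  open MatchingComplement M matching

  N : ℕ
  N = suc (2 * n)

  k≤2n : k ≤ 2 * n
  k≤2n = ≤-trans k≤n (m≤m+n n (n + 0))

  k+k≤2n : k + k ≤ 2 * n
  k+k≤2n = +-mono-≤ k≤n (subst (k ≤_) (sym (+-identityʳ n)) k≤n)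

  end₁ end₂ : Fin k → Fin N
  end₁ = proj₁ ∘ M
  end₂ = proj₂ ∘ M

  matchedVertex : Fin (k + k) → Fin N
  matchedVertex = end₁ ++ end₂

  matchedVertex-injective : Injective _≡_ _≡_ matchedVertex
  matchedVertex-injective = injective-++ (λ eq → endpoint-unique (inj₁ eq) (inj₁ refl))
                                         (λ eq → endpoint-unique (inj₂ eq) (inj₂ refl))
                                         disjoint
    where
    disjoint : ∀ i j → end₁ i ≢ end₂ j
    disjoint i j eq with refl ← endpoint-unique (inj₁ eq) (inj₂ refl) = proj₁ matching i eq

  matchedVertex-matched : ∀ x → ∃ λ v → InMatching M (matchedVertex x) v
  matchedVertex-matched x with splitAt k x
  ... | inj₁ i = end₂ i , i , inj₁ refl
  ... | inj₂ i = end₁ i , i , inj₂ refl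

  ∉matchedVertex⇒unmatched : ∀ {u} → u ∉-image matchedVertex → Unmatched u
  ∉matchedVertex⇒unmatched u∉ (i , inj₁ e) =
    u∉ (i ↑ˡ k) (trans (lookup-++ˡ end₁ end₂ i) (cong proj₁ e))
  ∉matchedVertex⇒unmatched u∉ (i , inj₂ e) =
    u∉ (k ↑ʳ i) (trans (lookup-++ʳ end₁ end₂ i) (cong proj₂ e))

  root∉ : ∃ λ w → w ∉-image matchedVertex
  root∉ = ∃-∉-image matchedVertex (s≤s k+k≤2n)

  root : Fin N
  root = proj₁ root∉

  root-unmatched : Unmatched root
  root-unmatched = ∉matchedVertex⇒unmatched (proj₂ root∉)

  spine : Fin (suc (k + k)) → Fin N
  spine = root ∷ matchedVertex

  spine-injective : Injective _≡_ _≡_ spine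
  spine-injective = injective-∷ (proj₂ root∉) matchedVertex-injective

  lowLabel : Fin k → Fin N
  lowLabel i = suc (inject≤ i k≤2n)

  highLabel : Fin k → Fin N
  highLabel i = opposite (inject≤ i (≤-trans k≤2n (n≤1+n _)))

  toℕ-lowLabel : ∀ i → toℕ (lowLabel i) ≡ suc (toℕ i)
  toℕ-lowLabel i = cong suc (toℕ-inject≤ i _)

  toℕ-highLabel : ∀ i → toℕ (highLabel i) ≡ 2 * n ∸ toℕ i
  toℕ-highLabel i = trans (opposite-prop (inject≤ i _)) (cong (2 * n ∸_) (toℕ-inject≤ i _))

  low≢high : ∀ i j → lowLabel i ≢ highLabel j
  low≢high i j eq = <⇒≱ (<-≤-trans (+-mono-≤-< (toℕ<n i) (toℕ<n j)) k+k≤2n) (≤-reflexive 2n≡)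
    where
    2n≡ : 2 * n ≡ suc (toℕ i) + toℕ j
    2n≡ = trans (sym (m∸n+n≡m (≤-trans (<⇒≤ (toℕ<n j)) k≤2n)))
                (cong (_+ toℕ j) (trans (sym (toℕ-highLabel j))
                                         (trans (cong toℕ (sym eq)) (toℕ-lowLabel i))))

  zero∉labels : zero ∉-image (lowLabel ++ highLabel)
  zero∉labels = ∉-image-++ (λ i ()) high≢0
    where
    high≢0 : ∀ j → highLabel j ≢ zero
    high≢0 j eq = <⇒≱ (<-≤-trans (toℕ<n j) k≤2n)
                      (m∸n≡0⇒m≤n (trans (sym (toℕ-highLabel j)) (cong toℕ eq)))

  labels : Fin (suc (k + k)) → Fin N
  labels = zero ∷ (lowLabel ++ highLabel)

  labels-injective : Injective _≡_ _≡_ labels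
  labels-injective = injective-∷ zero∉labels (injective-++ low-injective high-injective low≢high)
    where
    low-injective : Injective _≡_ _≡_ lowLabel
    low-injective eq = inject≤-injective _ _ _ _ (Fin.suc-injective eq)
    high-injective : Injective _≡_ _≡_ highLabel
    high-injective eq = inject≤-injective _ _ _ _
      (trans (sym (opposite-involutive _)) (trans (cong opposite eq) (opposite-involutive _)))

  relabel : ∃ λ (π : Fin N → Fin N) → Injective _≡_ _≡_ π × (∀ x → π (spine x) ≡ labels x)
  relabel = extend-to-permutation spine labels spine-injective labels-injective

  label : Fin N → ℕ
  label v = toℕ (proj₁ relabel v)

  label-spine : ∀ x → label (spine x) ≡ toℕ (labels x)
  label-spine x = cong toℕ (proj₂ (proj₂ relabel) x)

  label-root : label root ≡ 0
  label-root = label-spine zero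

  label-low : ∀ i → label (end₁ i) ≡ suc (toℕ i)
  label-low i = begin
    label (end₁ i)                           ≡⟨ cong label (lookup-++ˡ end₁ end₂ i) ⟨
    label (spine (suc (i ↑ˡ k)))             ≡⟨ label-spine (suc (i ↑ˡ k)) ⟩
    toℕ ((lowLabel ++ highLabel) (i ↑ˡ k))   ≡⟨ cong toℕ (lookup-++ˡ lowLabel highLabel i) ⟩
    toℕ (lowLabel i)                         ≡⟨ toℕ-lowLabel i ⟩
    suc (toℕ i)                              ∎

  label-high : ∀ i → label (end₂ i) ≡ 2 * n ∸ toℕ i
  label-high i = begin
    label (end₂ i)                           ≡⟨ cong label (lookup-++ʳ end₁ end₂ i) ⟨
    label (spine (suc (k ↑ʳ i)))             ≡⟨ label-spine (suc (k ↑ʳ i)) ⟩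
    toℕ ((lowLabel ++ highLabel) (k ↑ʳ i))   ≡⟨ cong toℕ (lookup-++ʳ lowLabel highLabel i) ⟩
    toℕ (highLabel i)                        ≡⟨ toℕ-highLabel i ⟩
    2 * n ∸ toℕ i                            ∎

  label-edge-sum : ∀ i → label (end₁ i) + label (end₂ i) ≡ N
  label-edge-sum i = trans (cong₂ _+_ (label-low i) (label-high i))
                           (cong suc (m+[n∸m]≡n (≤-trans (<⇒≤ (toℕ<n i)) k≤2n)))

  labelling : Labelling n M
  labelling = record
    { label           = label
    ; label<N         = λ v → toℕ<n (proj₁ relabel v)
    ; label-injective = λ eq → proj₁ (proj₂ relabel) (toℕ-injective eq)
    ; label-partner   = partner
    }
    where
    partner : ∀ {u v} → InMatching M u v → label u + label v ≡ N
    partner (i , inj₁ refl) = label-edge-sum i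
    partner (i , inj₂ refl) = trans (+-comm (label (end₂ i)) _) (label-edge-sum i)

  second-unmatched : k < n → ∃ λ w → w ≢ root × Unmatched w
  second-unmatched k<n =
    let w , w∉ = ∃-∉-image spine (s≤s (+-mono-< k<n (subst (k <_) (sym (+-identityʳ n)) k<n)))
    in w , (λ w≡root → w∉ zero (sym w≡root)) , ∉matchedVertex⇒unmatched (w∉ ∘ suc)

  root-or-matched : k ≡ n → ∀ v → v ≡ root ⊎ ∃ λ v′ → InMatching M v v′
  root-or-matched k≡n v with any? (λ x → matchedVertex x ≟ v)
  ... | yes (x , refl) = inj₂ (matchedVertex-matched x)
  ... | no  v∉ with v ≟ root
  ...   | yes v≡root = inj₁ v≡root
  ...   | no  v≢root = contradiction
      (subst (suc (k + k) ≤_) (sym k+k≡2n)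
             (s≤s⁻¹ (injective⇒≤ (injective-∷ v∉spine spine-injective))))
      (n≮n (k + k))
    where
    k+k≡2n : k + k ≡ 2 * n
    k+k≡2n = trans (cong (λ k → k + k) k≡n) (cong (n +_) (sym (+-identityʳ n)))
    v∉spine : v ∉-image spine
    v∉spine zero    eq = v≢root (sym eq)
    v∉spine (suc x) eq = v∉ (x , eq)

module _ {n k} (1≤n : 1 ≤ n) (k≤n : k ≤ n) (M : Fin k → Fin (suc (2 * n)) × Fin (suc (2 * n)))
         (matching : IsMatching M) where
  open MatchingComplement M matching
  open LabellingConstruction k≤n M matching
  open LabelSums n matching labelling hiding (N)
  open EdgeLocatingColoring using (coloring)

  2≤2n : 2 ≤ 2 * n
  2≤2n = *-monoʳ-≤ 2 1≤n

  root-diagonal : labelSum root root ≡ 0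
  root-diagonal = cong (λ l → (l + l) % N) label-root

  index-small-matching : k < n → EdgeLocatingChromaticIndex G N
  index-small-matching k<n =
    SumColouring.edgeLocatingColouring 0 z≤n 2≤2n (λ _ → z≤n) source , minimal
    where
    w = proj₁ (second-unmatched k<n)
    w≢root = proj₁ (proj₂ (second-unmatched k<n))
    w-unmatched = proj₂ (proj₂ (second-unmatched k<n))
    source : ∀ t → 0 ≤ t → t < N → ∃ λ z → Unmatched z × labelSum z z ≢ t
    source zero    _ _ = w , w-unmatched ,
                         λ ww≡0 → w≢root (labelSum-diag-injective (trans ww≡0 (sym root-diagonal)))
    source (suc t) _ _ = root , root-unmatched , λ eq → 0≢1+n (trans (sym root-diagonal) eq)
    minimal : ∀ j → EdgeLocatingColoring G j → N ≤ j
    minimal j el = ≤∧≢⇒< (unmatched⇒≤colours (coloring el) root-unmatched)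
      λ { refl → two-unmatched⇒¬locating root-unmatched w-unmatched (w≢root ∘ sym) el }

  index-near-perfect-matching : k ≡ n → EdgeLocatingChromaticIndex G (2 * n)
  index-near-perfect-matching k≡n =
    SumColouring.edgeLocatingColouring 1 (s≤s z≤n) 2≤2n edge-sum≢0 source ,
    λ j el → unmatched⇒≤colours (coloring el) root-unmatched
    where
    covered : ∀ u → label u ≡ 0 ⊎ ∃ λ u′ → InMatching M u u′
    covered u with root-or-matched k≡n u
    ... | inj₁ refl    = inj₁ label-root
    ... | inj₂ matched = inj₂ matched
    edge-sum≢0 : ∀ {u v} → G u v → 1 ≤ labelSum u v
    edge-sum≢0 (u≢v , ¬uv) = n≢0⇒n>0 (¬uv ∘ matched-if-sum≡0 covered u≢v)
    source : ∀ t → 1 ≤ t → t < N → ∃ λ z → Unmatched z × labelSum z z ≢ t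
    source t 1≤t _ = root , root-unmatched , λ eq → <⇒≢ 1≤t (trans (sym root-diagonal) eq)

theorem10 : (n k : ℕ) → 1 ≤ n → 1 ≤ k → k ≤ n →
            (M : Fin k → Fin (suc (2 * n)) × Fin (suc (2 * n))) → IsMatching M →
            (k < n → EdgeLocatingChromaticIndex (CompleteMinus M) (suc (2 * n)))
            × (k ≡ n → EdgeLocatingChromaticIndex (CompleteMinus M) (2 * n))
theorem10 n k 1≤n _ k≤n M matching =
  index-small-matching 1≤n k≤n M matching , index-near-perfect-matching 1≤n k≤n M matching
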